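{- Let $n\ge1$ and $a\ge 2$ be integers with $2a-1<n$, and let $\sigma$ be a uniformly random permutation of $\{1,\ldots,n\}$. Then for every integer $t$, $\Pr[D_{a,a-1}(\sigma)\equiv t\pmod n]=\frac1n$.
   Context: For positive integers $a,b$ with $a+b<n$ and a permutation $\sigma$ of $\{1,\ldots,n\}$, define $D_{a,b}(\sigma)=\sum_{i=1}^{a}\sigma(i)-\sum_{i=a+1}^{a+b}\sigma(i)$. -}

module Defs where

open import Data.Nat using (ℕ; zero; suc)
open import Data.List using (List; []; _∷_; concatMap; map; take; drop; upTo)
open import Data.Nat.ListAction using (sum)
open import Data.Integer using (ℤ; +_; _-_)

insertions : ℕ → List ℕ → List (List ℕ)
insertions x []       = (x ∷ []) ∷ []
insertions x (y ∷ ys) = (x ∷ y ∷ ys) ∷ map (y ∷_) (insertions x ys)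

-- all permutations (as arrangements) of a list; for a list of distinct elements
-- each arrangement occurs exactly once
perms : List ℕ → List (List ℕ)
perms []       = [] ∷ []
perms (x ∷ xs) = concatMap (insertions x) (perms xs)

oneTo : ℕ → List ℕ
oneTo n = map suc (upTo n)

-- all permutations σ of {1,...,n}, each given as the list [σ(1), ..., σ(n)]
Perms : ℕ → List (List ℕ)
Perms n = perms (oneTo n)

D : ℕ → ℕ → List ℕ → ℤ
D a b σ = (+ sum (take a σ)) - (+ sum (take b (drop a σ)))

-- Rotating the values of σ by v ↦ v + 1 (mod n), i.e. 1 ↦ 2 ↦ ⋯ ↦ n ↦ 1, permutes the
-- arrangements of {1,…,n}; it changes each of the a added and a − 1 subtracted entries
-- by 1 modulo n, hence D_{a,a−1} by a − (a − 1) = 1. So the number of σ with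
-- D_{a,a−1}(σ) ≡ t is the same for every residue t, and these n numbers add up to n!.
module Submission where

open import Defs
open import Data.Nat using (ℕ; zero; suc; _+_; _*_; _∸_; _≤_; _<_; _≟_; _!; s≤s; NonZero)
open import Data.Nat.Properties
import Data.Nat.Divisibility as ℕᵈ
open import Data.Nat.ListAction using (sum)
open import Data.Integer using (ℤ; +_; _-_)
import Data.Integer as ℤ
import Data.Integer.Properties as ℤ
open import Data.Integer.Divisibility.Signed
  using (_∣_; _∣?_; divides; ∣-refl; ∣⇒∣ᵤ; ∣m∣n⇒∣m+n; ∣m∣n⇒∣m-n; ∣m+n∣n⇒∣m; ∣n⇒∣m*n)
open import Data.Integer.DivMod using (n%ℕd<d; a≡a%ℕn+[a/ℕn]*n)
open import Data.Integer.Tactic.RingSolver using (solve-∀)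
open import Algebra.Properties.CommutativeSemigroup +-commutativeSemigroup
  using () renaming (interchange to +-interchange)
open import Data.List
  using (List; []; _∷_; _++_; _∷ʳ_; map; concatMap; length; filter; upTo; take; drop)
open import Data.List.Properties
  using ( map-∘; map-++; map-cong-local; map-upTo; upTo-∷ʳ; concatMap-cong; concatMap-map
        ; map-concatMap; take-map; drop-map; length-map; length-++; length-upTo; length-take
        ; length-drop)
open import Data.List.Effectful using (module MonadProperties)
open import Data.List.Relation.Binary.Permutation.Propositional
open import Data.List.Relation.Binary.Permutation.Propositional.Properties
  using (++⁺ˡ; ++⁺; shifts; map⁺; ∷↭∷ʳ; ↭-length; filter-↭)
open import Data.List.Relation.Unary.All using (All; []; _∷_)
import Data.List.Relation.Unary.All as All
import Data.List.Relation.Unary.All.Properties as All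
open import Function using (_∘_)
open import Function.Bundles using (_⇔_; mk⇔; Equivalence)
open import Relation.Nullary using (Dec; yes; no; contradiction)
open import Relation.Unary using (Pred; Decidable)
open import Relation.Binary.PropositionalEquality as ≡
  using (_≡_; refl; sym; cong; cong₂; subst; module ≡-Reasoning)

-- Permutations of a list

module _ {A B : Set} where

  concatMap⁺ : (f : A → List B) {xs ys : List A} → xs ↭ ys → concatMap f xs ↭ concatMap f ys
  concatMap⁺ f refl         = refl
  concatMap⁺ f (prep x p)   = ++⁺ˡ (f x) (concatMap⁺ f p)
  concatMap⁺ f (swap x y p) = trans (shifts (f x) (f y)) (++⁺ˡ (f y) (++⁺ˡ (f x) (concatMap⁺ f p)))
  concatMap⁺ f (trans p q)  = trans (concatMap⁺ f p) (concatMap⁺ f q)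

  concatMap-↭-pointwise : {f g : A → List B} → (∀ x → f x ↭ g x) →
                          ∀ xs → concatMap f xs ↭ concatMap g xs
  concatMap-↭-pointwise f↭g []       = refl
  concatMap-↭-pointwise f↭g (x ∷ xs) = ++⁺ (f↭g x) (concatMap-↭-pointwise f↭g xs)

  concatMap-∷ : (f : A → B) (g : A → List B) (xs : List A) →
                concatMap (λ x → f x ∷ g x) xs ↭ map f xs ++ concatMap g xs
  concatMap-∷ f g []       = refl
  concatMap-∷ f g (x ∷ xs) =
    prep (f x) (trans (++⁺ˡ (g x) (concatMap-∷ f g xs)) (shifts (g x) (map f xs)))

insertions-under-∷ : ∀ x z (L : List (List ℕ)) →
  concatMap (insertions x) (map (z ∷_) L) ↭ map (λ w → x ∷ z ∷ w) L ++ map (z ∷_) (concatMap (insertions x) L)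
insertions-under-∷ x z L = begin
  concatMap (insertions x) (map (z ∷_) L)
    ≡⟨ concatMap-map (insertions x) (z ∷_) L ⟩
  concatMap (λ w → (x ∷ z ∷ w) ∷ map (z ∷_) (insertions x w)) L
    ↭⟨ concatMap-∷ (λ w → x ∷ z ∷ w) (map (z ∷_) ∘ insertions x) L ⟩
  map (λ w → x ∷ z ∷ w) L ++ concatMap (map (z ∷_) ∘ insertions x) L
    ≡⟨ cong (map (λ w → x ∷ z ∷ w) L ++_) (map-concatMap (z ∷_) (insertions x) L) ⟨
  map (λ w → x ∷ z ∷ w) L ++ map (z ∷_) (concatMap (insertions x) L) ∎
  where open PermutationReasoning

-- Up to swapping the first two entries and the two middle blocks, the right-hand side is
-- symmetric in x and y.
insertions-insertions : ∀ x y z zs →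
  concatMap (insertions x) (insertions y (z ∷ zs)) ↭
  (x ∷ y ∷ z ∷ zs) ∷ (y ∷ x ∷ z ∷ zs) ∷
    (map (λ w → y ∷ z ∷ w) (insertions x zs) ++ map (λ w → x ∷ z ∷ w) (insertions y zs) ++
     map (z ∷_) (concatMap (insertions x) (insertions y zs)))
insertions-insertions x y z zs = prep _ (prep _ (begin
  map (y ∷_) (map (z ∷_) (insertions x zs)) ++ concatMap (insertions x) (map (z ∷_) (insertions y zs))
    ≡⟨ cong (_++ concatMap (insertions x) (map (z ∷_) (insertions y zs))) (map-∘ (insertions x zs)) ⟨
  map (λ w → y ∷ z ∷ w) (insertions x zs) ++ concatMap (insertions x) (map (z ∷_) (insertions y zs))
    ↭⟨ ++⁺ˡ (map (λ w → y ∷ z ∷ w) (insertions x zs)) (insertions-under-∷ x z (insertions y zs)) ⟩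
  map (λ w → y ∷ z ∷ w) (insertions x zs) ++ map (λ w → x ∷ z ∷ w) (insertions y zs) ++
    map (z ∷_) (concatMap (insertions x) (insertions y zs)) ∎))
  where open PermutationReasoning

insertions-comm : ∀ x y zs →
  concatMap (insertions x) (insertions y zs) ↭ concatMap (insertions y) (insertions x zs)
insertions-comm x y []       = swap _ _ refl
insertions-comm x y (z ∷ zs) = begin
  concatMap (insertions x) (insertions y (z ∷ zs))
    ↭⟨ insertions-insertions x y z zs ⟩
  (x ∷ y ∷ z ∷ zs) ∷ (y ∷ x ∷ z ∷ zs) ∷ (A ++ B ++ map (z ∷_) (concatMap (insertions x) (insertions y zs)))
    ↭⟨ swap _ _ (shifts A B) ⟩
  (y ∷ x ∷ z ∷ zs) ∷ (x ∷ y ∷ z ∷ zs) ∷ (B ++ A ++ map (z ∷_) (concatMap (insertions x) (insertions y zs)))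
    ↭⟨ prep _ (prep _ (++⁺ˡ B (++⁺ˡ A (map⁺ (z ∷_) (insertions-comm x y zs))))) ⟩
  (y ∷ x ∷ z ∷ zs) ∷ (x ∷ y ∷ z ∷ zs) ∷ (B ++ A ++ map (z ∷_) (concatMap (insertions y) (insertions x zs)))
    ↭⟨ insertions-insertions y x z zs ⟨
  concatMap (insertions y) (insertions x (z ∷ zs)) ∎
  where
  open PermutationReasoning
  A B : List (List ℕ)
  A = map (λ w → y ∷ z ∷ w) (insertions x zs)
  B = map (λ w → x ∷ z ∷ w) (insertions y zs)

perms-↭ : {xs ys : List ℕ} → xs ↭ ys → perms xs ↭ perms ys
perms-↭ refl                = refl
perms-↭ (prep x p)          = concatMap⁺ (insertions x) (perms-↭ p)
perms-↭ {x ∷ y ∷ xs} {.y ∷ .x ∷ ys} (swap x y p) = begin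
  concatMap (insertions x) (concatMap (insertions y) (perms xs))
    ≡⟨ MonadProperties.associative (perms xs) (insertions y) (insertions x) ⟨
  concatMap (λ p → concatMap (insertions x) (insertions y p)) (perms xs)
    ↭⟨ concatMap-↭-pointwise (insertions-comm x y) (perms xs) ⟩
  concatMap (λ p → concatMap (insertions y) (insertions x p)) (perms xs)
    ≡⟨ MonadProperties.associative (perms xs) (insertions x) (insertions y) ⟩
  concatMap (insertions y) (concatMap (insertions x) (perms xs))
    ↭⟨ concatMap⁺ (insertions y) (concatMap⁺ (insertions x) (perms-↭ p)) ⟩
  perms (y ∷ x ∷ ys) ∎
  where open PermutationReasoning
perms-↭ (trans p q)         = trans (perms-↭ p) (perms-↭ q)

insertions-map : (f : ℕ → ℕ) (x : ℕ) (ys : List ℕ) →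
                 insertions (f x) (map f ys) ≡ map (map f) (insertions x ys)
insertions-map f x []       = refl
insertions-map f x (y ∷ ys) = cong ((f x ∷ f y ∷ map f ys) ∷_) (begin
  map (f y ∷_) (insertions (f x) (map f ys))     ≡⟨ cong (map (f y ∷_)) (insertions-map f x ys) ⟩
  map (f y ∷_) (map (map f) (insertions x ys))   ≡⟨ map-∘ (insertions x ys) ⟨
  map (map f ∘ (y ∷_)) (insertions x ys)          ≡⟨ map-∘ (insertions x ys) ⟩
  map (map f) (map (y ∷_) (insertions x ys))     ∎)
  where open ≡-Reasoning

perms-map : (f : ℕ → ℕ) (xs : List ℕ) → perms (map f xs) ≡ map (map f) (perms xs)
perms-map f []       = refl
perms-map f (x ∷ xs) = begin
  concatMap (insertions (f x)) (perms (map f xs))          ≡⟨ cong (concatMap (insertions (f x))) (perms-map f xs) ⟩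
  concatMap (insertions (f x)) (map (map f) (perms xs))    ≡⟨ concatMap-map (insertions (f x)) (map f) (perms xs) ⟩
  concatMap (insertions (f x) ∘ map f) (perms xs)          ≡⟨ concatMap-cong (insertions-map f x) (perms xs) ⟩
  concatMap (map (map f) ∘ insertions x) (perms xs)        ≡⟨ map-concatMap (map f) (insertions x) (perms xs) ⟨
  map (map f) (concatMap (insertions x) (perms xs))        ∎
  where open ≡-Reasoning

insertions-length : ∀ x ys → All (λ zs → length zs ≡ suc (length ys)) (insertions x ys)
insertions-length x []       = refl ∷ []
insertions-length x (y ∷ ys) = refl ∷ All.map⁺ (All.map (cong suc) (insertions-length x ys))

length-insertions : ∀ x ys → length (insertions x ys) ≡ suc (length ys)
length-insertions x []       = refl
length-insertions x (y ∷ ys) = cong suc (≡.trans (length-map (y ∷_) (insertions x ys)) (length-insertions x ys))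

perms-length : ∀ xs → All (λ σ → length σ ≡ length xs) (perms xs)
perms-length []       = refl ∷ []
perms-length (x ∷ xs) = All.concat⁺ (All.map⁺ (All.map
  (λ {σ} σ-len → All.map (λ τ-len → ≡.trans τ-len (cong suc σ-len)) (insertions-length x σ))
  (perms-length xs)))

length-concatMap-const : {A B : Set} (f : A → List B) {k : ℕ} {xs : List A} →
                         All (λ x → length (f x) ≡ k) xs → length (concatMap f xs) ≡ length xs * k
length-concatMap-const f []               = refl
length-concatMap-const f {xs = x ∷ xs} (fx-len ∷ fxs-len) =
  ≡.trans (length-++ (f x)) (cong₂ _+_ fx-len (length-concatMap-const f fxs-len))

length-perms : ∀ xs → length (perms xs) ≡ length xs !
length-perms []       = refl
length-perms (x ∷ xs) = begin
  length (concatMap (insertions x) (perms xs))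
    ≡⟨ length-concatMap-const (insertions x)
         (All.map (λ {σ} σ-len → ≡.trans (length-insertions x σ) (cong suc σ-len)) (perms-length xs)) ⟩
  length (perms xs) * suc (length xs)   ≡⟨ cong (_* suc (length xs)) (length-perms xs) ⟩
  length xs ! * suc (length xs)         ≡⟨ *-comm (length xs !) (suc (length xs)) ⟩
  suc (length xs) !                     ∎
  where open ≡-Reasoning

-- The rotation of the values

rotate : ℕ → ℕ → ℕ
rotate n v with v ≟ n
... | yes _ = 1
... | no  _ = suc v

rotate-< : ∀ {n v} → v < n → rotate n v ≡ suc v
rotate-< {n} {v} v<n with v ≟ n
... | yes refl = contradiction v<n (<-irrefl refl)
... | no  _    = refl

rotate-self : ∀ n → rotate n n ≡ 1
rotate-self n with n ≟ n
... | yes _ = refl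
... | no  n≢n = contradiction refl n≢n

oneTo-suc : ∀ m → oneTo (suc m) ≡ 1 ∷ map suc (oneTo m)
oneTo-suc m = cong (λ xs → 1 ∷ map suc xs) (sym (map-upTo suc m))

oneTo-∷ʳ : ∀ m → oneTo (suc m) ≡ oneTo m ∷ʳ suc m
oneTo-∷ʳ m = ≡.trans (cong (map suc) (sym (upTo-∷ʳ m))) (map-++ suc (upTo m) (m ∷ []))

rotate-oneTo : ∀ n → map (rotate n) (oneTo n) ↭ oneTo n
rotate-oneTo zero    = refl
rotate-oneTo (suc m) = begin
  map (rotate (suc m)) (oneTo (suc m))                   ≡⟨ cong (map (rotate (suc m))) (oneTo-∷ʳ m) ⟩
  map (rotate (suc m)) (oneTo m ∷ʳ suc m)                ≡⟨ map-++ (rotate (suc m)) (oneTo m) (suc m ∷ []) ⟩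
  map (rotate (suc m)) (oneTo m) ∷ʳ rotate (suc m) (suc m) ≡⟨ cong₂ _∷ʳ_ below (rotate-self (suc m)) ⟩
  map suc (oneTo m) ∷ʳ 1                                  ↭⟨ ∷↭∷ʳ 1 (map suc (oneTo m)) ⟨
  1 ∷ map suc (oneTo m)                                   ≡⟨ oneTo-suc m ⟨
  oneTo (suc m)                                           ∎
  where
  open PermutationReasoning
  below : map (rotate (suc m)) (oneTo m) ≡ map suc (oneTo m)
  below = map-cong-local (All.map⁺ (All.map (λ i<m → rotate-< (s≤s i<m)) (All.all-upTo m)))

Perms-rotate : ∀ n → Perms n ↭ map (map (rotate n)) (Perms n)
Perms-rotate n = begin
  perms (oneTo n)                       ↭⟨ perms-↭ (rotate-oneTo n) ⟨
  perms (map (rotate n) (oneTo n))      ≡⟨ perms-map (rotate n) (oneTo n) ⟩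
  map (map (rotate n)) (perms (oneTo n)) ∎
  where open PermutationReasoning

-- The statistic D modulo n

+[m+n]-+[o+p] : ∀ m n o p → + (m + n) - + (o + p) ≡ (+ m - + o) ℤ.+ (+ n - + p)
+[m+n]-+[o+p] m n o p = begin
  + (m + n) - + (o + p)                  ≡⟨ cong₂ _-_ (ℤ.pos-+ m n) (ℤ.pos-+ o p) ⟩
  (+ m ℤ.+ + n) - (+ o ℤ.+ + p)          ≡⟨ rearrange (+ m) (+ n) (+ o) (+ p) ⟩
  (+ m - + o) ℤ.+ (+ n - + p)            ∎
  where
  open ≡-Reasoning
  rearrange : ∀ (w x y z : ℤ) → (w ℤ.+ x) - (y ℤ.+ z) ≡ (w - y) ℤ.+ (x - z)
  rearrange = solve-∀

rotate-≡-suc : ∀ n v → + n ∣ + rotate n v - + suc v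
rotate-≡-suc n v with v ≟ n
... | yes refl = divides (ℤ.- + 1) (≡.trans (cong (+ 1 -_) (ℤ.pos-+ 1 n)) (wrap (+ n)))
  where
  wrap : ∀ x → + 1 - (+ 1 ℤ.+ x) ≡ ℤ.- + 1 ℤ.* x
  wrap = solve-∀
... | no  _    = divides (+ 0) (ℤ.+-inverseʳ (+ suc v))

sum-map-∣ : ∀ {n} {f g : ℕ → ℕ} → (∀ v → + n ∣ + f v - + g v) →
            ∀ xs → + n ∣ + sum (map f xs) - + sum (map g xs)
sum-map-∣ f≡g []       = divides (+ 0) refl
sum-map-∣ {n} {f} {g} f≡g (x ∷ xs) =
  subst (+ n ∣_) (sym (+[m+n]-+[o+p] (f x) (sum (map f xs)) (g x) (sum (map g xs))))
        (∣m∣n⇒∣m+n (f≡g x) (sum-map-∣ f≡g xs))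

sum-map-suc : ∀ xs → sum (map suc xs) ≡ sum xs + length xs
sum-map-suc []       = refl
sum-map-suc (x ∷ xs) = begin
  suc x + sum (map suc xs)     ≡⟨ cong (_+_ (suc x)) (sum-map-suc xs) ⟩
  suc x + (sum xs + length xs) ≡⟨ cong suc (+-assoc x (sum xs) (length xs)) ⟨
  suc (x + sum xs + length xs) ≡⟨ +-suc (x + sum xs) (length xs) ⟨
  x + sum xs + suc (length xs) ∎
  where open ≡-Reasoning

length-take-≤ : ∀ {A : Set} k (xs : List A) → k ≤ length xs → length (take k xs) ≡ k
length-take-≤ k xs k≤len = ≡.trans (length-take k xs) (m≤n⇒m⊓n≡m k≤len)

D-map : ∀ a b (f : ℕ → ℕ) σ →
        D a b (map f σ) ≡ + sum (map f (take a σ)) - + sum (map f (take b (drop a σ)))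
D-map a b f σ = cong₂ (λ xs ys → + sum xs - + sum ys) (take-map a σ)
  (≡.trans (cong (take b) (drop-map a σ)) (take-map b (drop a σ)))

D-map-∣ : ∀ {n} a b {f g : ℕ → ℕ} → (∀ v → + n ∣ + f v - + g v) →
          ∀ σ → + n ∣ D a b (map f σ) - D a b (map g σ)
D-map-∣ {n} a b {f} {g} f≡g σ =
  subst (+ n ∣_) (sym differences)
        (∣m∣n⇒∣m-n (sum-map-∣ f≡g (take a σ)) (sum-map-∣ f≡g (take b (drop a σ))))
  where
  open ≡-Reasoning
  Σf₁ Σf₂ Σg₁ Σg₂ : ℤ
  Σf₁ = + sum (map f (take a σ))
  Σf₂ = + sum (map f (take b (drop a σ)))
  Σg₁ = + sum (map g (take a σ))
  Σg₂ = + sum (map g (take b (drop a σ)))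
  rearrange : ∀ (w x y z : ℤ) → (w - x) - (y - z) ≡ (w - y) - (x - z)
  rearrange = solve-∀
  differences : D a b (map f σ) - D a b (map g σ) ≡ (Σf₁ - Σg₁) - (Σf₂ - Σg₂)
  differences = begin
    D a b (map f σ) - D a b (map g σ)  ≡⟨ cong₂ _-_ (D-map a b f σ) (D-map a b g σ) ⟩
    (Σf₁ - Σf₂) - (Σg₁ - Σg₂)          ≡⟨ rearrange Σf₁ Σf₂ Σg₁ Σg₂ ⟩
    (Σf₁ - Σg₁) - (Σf₂ - Σg₂)          ∎

D-map-suc : ∀ a b σ → a + b ≤ length σ → D a b (map suc σ) ≡ D a b σ ℤ.+ (+ a - + b)
D-map-suc a b σ a+b≤len = begin
  D a b (map suc σ)                                ≡⟨ D-map a b suc σ ⟩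
  + sum (map suc front) - + sum (map suc back)     ≡⟨ cong₂ (λ x y → + x - + y) (sum-map-suc front) (sum-map-suc back) ⟩
  + (sum front + length front) - + (sum back + length back)
    ≡⟨ cong₂ (λ x y → + (sum front + x) - + (sum back + y)) front-length back-length ⟩
  + (sum front + a) - + (sum back + b)             ≡⟨ +[m+n]-+[o+p] (sum front) a (sum back) b ⟩
  D a b σ ℤ.+ (+ a - + b)                          ∎
  where
  open ≡-Reasoning
  front back : List ℕ
  front = take a σ
  back  = take b (drop a σ)
  front-length : length front ≡ a
  front-length = length-take-≤ a σ (m+n≤o⇒m≤o a a+b≤len)
  back-length : length back ≡ b
  back-length = length-take-≤ b (drop a σ)
    (subst (b ≤_) (sym (length-drop a σ)) (m+n≤o⇒m≤o∸n b (subst (_≤ length σ) (+-comm a b) a+b≤len)))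

D-rotate-∣ : ∀ n a b σ → a + b ≤ length σ →
             + n ∣ D a b (map (rotate n) σ) - (D a b σ ℤ.+ (+ a - + b))
D-rotate-∣ n a b σ a+b≤len =
  subst (λ x → + n ∣ D a b (map (rotate n) σ) - x) (D-map-suc a b σ a+b≤len)
        (D-map-∣ a b (rotate-≡-suc n) σ)

indicator : ∀ {p} {P : Set p} → Dec P → ℕ
indicator (yes _) = 1
indicator (no  _) = 0

indicator-cong : ∀ {p q} {P : Set p} {Q : Set q} (P? : Dec P) (Q? : Dec Q) → P ⇔ Q → indicator P? ≡ indicator Q?
indicator-cong (yes _)  (yes _)  P⇔Q = refl
indicator-cong (yes p)  (no ¬q)  P⇔Q = contradiction (Equivalence.to P⇔Q p) ¬q
indicator-cong (no ¬p)  (yes q)  P⇔Q = contradiction (Equivalence.from P⇔Q q) ¬p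
indicator-cong (no _)   (no _)   P⇔Q = refl

length-filter-∷ : ∀ {A : Set} {p} {P : Pred A p} (P? : Decidable P) (x : A) (xs : List A) →
                  length (filter P? (x ∷ xs)) ≡ indicator (P? x) + length (filter P? xs)
length-filter-∷ P? x xs with P? x
... | yes _ = refl
... | no  _ = refl

length-filter-cong : ∀ {A : Set} {p q} {P : Pred A p} {Q : Pred A q} (P? : Decidable P) (Q? : Decidable Q) {xs : List A} →
                     All (λ x → P x ⇔ Q x) xs → length (filter P? xs) ≡ length (filter Q? xs)
length-filter-cong P? Q? []                        = refl
length-filter-cong P? Q? {x ∷ xs} (P⇔Q ∷ xs-P⇔Q) = begin
  length (filter P? (x ∷ xs))                       ≡⟨ length-filter-∷ P? x xs ⟩
  indicator (P? x) + length (filter P? xs)          ≡⟨ cong₂ _+_ (indicator-cong (P? x) (Q? x) P⇔Q)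
                                                                 (length-filter-cong P? Q? xs-P⇔Q) ⟩
  indicator (Q? x) + length (filter Q? xs)          ≡⟨ length-filter-∷ Q? x xs ⟨
  length (filter Q? (x ∷ xs))                       ∎
  where open ≡-Reasoning

length-filter-map : ∀ {A B : Set} {p} {P : Pred A p} (P? : Decidable P) (f : B → A) (xs : List B) →
                    length (filter P? (map f xs)) ≡ length (filter (P? ∘ f) xs)
length-filter-map P? f []       = refl
length-filter-map P? f (x ∷ xs) = begin
  length (filter P? (map f (x ∷ xs)))                   ≡⟨ length-filter-∷ P? (f x) (map f xs) ⟩
  indicator (P? (f x)) + length (filter P? (map f xs))  ≡⟨ cong (_+_ (indicator (P? (f x)))) (length-filter-map P? f xs) ⟩
  indicator (P? (f x)) + length (filter (P? ∘ f) xs)    ≡⟨ length-filter-∷ (P? ∘ f) x xs ⟨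
  length (filter (P? ∘ f) (x ∷ xs))                     ∎
  where open ≡-Reasoning

sumBelow : ℕ → (ℕ → ℕ) → ℕ
sumBelow zero    f = 0
sumBelow (suc n) f = sumBelow n f + f n

sumBelow-cong : ∀ n {f g : ℕ → ℕ} → (∀ k → k < n → f k ≡ g k) → sumBelow n f ≡ sumBelow n g
sumBelow-cong zero    f≡g = refl
sumBelow-cong (suc n) f≡g = cong₂ _+_ (sumBelow-cong n (λ k k<n → f≡g k (m≤n⇒m≤1+n k<n))) (f≡g n ≤-refl)

sumBelow-+ : ∀ n (f g : ℕ → ℕ) → sumBelow n (λ k → f k + g k) ≡ sumBelow n f + sumBelow n g
sumBelow-+ zero    f g = refl
sumBelow-+ (suc n) f g = ≡.trans (cong (_+ (f n + g n)) (sumBelow-+ n f g))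
                                  (+-interchange (sumBelow n f) (sumBelow n g) (f n) (g n))

sumBelow-const : ∀ n c → sumBelow n (λ _ → c) ≡ n * c
sumBelow-const zero    c = refl
sumBelow-const (suc n) c = ≡.trans (cong (_+ c) (sumBelow-const n c)) (+-comm (n * c) c)

sumBelow-indicator-≟-≤ : ∀ {r} n → n ≤ r → sumBelow n (λ k → indicator (r ≟ k)) ≡ 0
sumBelow-indicator-≟-≤ zero _ = refl
sumBelow-indicator-≟-≤ {r} (suc n) n<r with r ≟ n
... | yes refl = contradiction n<r (<-irrefl refl)
... | no  _    = ≡.trans (+-identityʳ _) (sumBelow-indicator-≟-≤ n (<⇒≤ n<r))

sumBelow-indicator-≟ : ∀ {r} n → r < n → sumBelow n (λ k → indicator (r ≟ k)) ≡ 1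
sumBelow-indicator-≟ {r} (suc n) r<1+n with r ≟ n
... | yes refl = cong (_+ 1) (sumBelow-indicator-≟-≤ n ≤-refl)
... | no  r≢n  = ≡.trans (+-identityʳ _) (sumBelow-indicator-≟ n (≤∧≢⇒< (≤-pred r<1+n) r≢n))

sumBelow-length-filter : ∀ {A : Set} {p} {P : ℕ → Pred A p} (P? : ∀ k → Decidable (P k)) n →
  (∀ x → sumBelow n (λ k → indicator (P? k x)) ≡ 1) →
  ∀ xs → sumBelow n (λ k → length (filter (P? k) xs)) ≡ length xs
sumBelow-length-filter P? n unique []       = ≡.trans (sumBelow-const n 0) (*-zeroʳ n)
sumBelow-length-filter P? n unique (x ∷ xs) = begin
  sumBelow n (λ k → length (filter (P? k) (x ∷ xs)))
    ≡⟨ sumBelow-cong n (λ k _ → length-filter-∷ (P? k) x xs) ⟩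
  sumBelow n (λ k → indicator (P? k x) + length (filter (P? k) xs))
    ≡⟨ sumBelow-+ n (λ k → indicator (P? k x)) (λ k → length (filter (P? k) xs)) ⟩
  sumBelow n (λ k → indicator (P? k x)) + sumBelow n (λ k → length (filter (P? k) xs))
    ≡⟨ cong₂ _+_ (unique x) (sumBelow-length-filter P? n unique xs) ⟩
  suc (length xs) ∎
  where open ≡-Reasoning

-- Residues modulo n

∣-+-multiple : ∀ {i y z} → i ∣ z → (i ∣ y ℤ.+ z) ⇔ (i ∣ y)
∣-+-multiple i∣z = mk⇔ (λ i∣y+z → ∣m+n∣n⇒∣m i∣y+z i∣z) (λ i∣y → ∣m∣n⇒∣m+n i∣y i∣z)

∣∧<⇒≡0 : ∀ {d m} → d ℕᵈ.∣ m → m < d → m ≡ 0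
∣∧<⇒≡0 {m = zero}  _   _   = refl
∣∧<⇒≡0 {m = suc m} d∣m m<d = contradiction d∣m (ℕᵈ.>⇒∤ m<d)

∣-residues⇒≡ : ∀ {n r k} → r < n → k < n → + n ∣ + r - + k → r ≡ k
∣-residues⇒≡ {n} {r} {k} r<n k<n n∣r-k =
  ℤ.+-injective (ℤ.i-j≡0⇒i≡j (+ r) (+ k) (ℤ.∣i∣≡0⇒i≡0 (∣∧<⇒≡0 (∣⇒∣ᵤ n∣r-k) ∣r-k∣<n)))
  where
  ∣r-k∣<n : ℤ.∣ + r - + k ∣ < n
  ∣r-k∣<n = subst (_< n) (cong ℤ.∣_∣ (sym (ℤ.m-n≡m⊖n r k)))
                  (≤-<-trans (ℤ.∣m⊝n∣≤m⊔n r k) (⊔-lub r<n k<n))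

exactly-one-residue : ∀ n .{{_ : NonZero n}} x t →
  sumBelow n (λ k → indicator (+ n ∣? x - (t ℤ.+ + k))) ≡ 1
exactly-one-residue n x t = ≡.trans (sumBelow-cong n (λ k k<n → indicator-cong _ (r ≟ k) (residue⇔ k k<n)))
                                    (sumBelow-indicator-≟ n r<n)
  where
  r : ℕ
  r = (x - t) ℤ.%ℕ n
  q : ℤ
  q = (x - t) ℤ./ℕ n
  r<n : r < n
  r<n = n%ℕd<d (x - t) n
  n∣q*n : + n ∣ q ℤ.* + n
  n∣q*n = ∣n⇒∣m*n q ∣-refl
  decompose : ∀ k → x - (t ℤ.+ + k) ≡ (+ r - + k) ℤ.+ q ℤ.* + n
  decompose k = begin
    x - (t ℤ.+ + k)                 ≡⟨ split x t (+ k) ⟩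
    (x - t) - + k                   ≡⟨ cong (_- + k) (a≡a%ℕn+[a/ℕn]*n (x - t) n) ⟩
    (+ r ℤ.+ q ℤ.* + n) - + k       ≡⟨ regroup (+ r) (q ℤ.* + n) (+ k) ⟩
    (+ r - + k) ℤ.+ q ℤ.* + n       ∎
    where
    open ≡-Reasoning
    split : ∀ (x t k : ℤ) → x - (t ℤ.+ k) ≡ (x - t) - k
    split = solve-∀
    regroup : ∀ (r m k : ℤ) → (r ℤ.+ m) - k ≡ (r - k) ℤ.+ m
    regroup = solve-∀
  residue⇔ : ∀ k → k < n → (+ n ∣ x - (t ℤ.+ + k)) ⇔ (r ≡ k)
  residue⇔ k k<n = mk⇔
    (λ n∣x-[t+k] → ∣-residues⇒≡ r<n k<n
      (Equivalence.to (∣-+-multiple n∣q*n) (subst (+ n ∣_) (decompose k) n∣x-[t+k])))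
    (λ { refl → subst (+ n ∣_) (sym (decompose r))
                  (Equivalence.from (∣-+-multiple n∣q*n) (divides (+ 0) (ℤ.+-inverseʳ (+ r)))) })

length-oneTo : ∀ n → length (oneTo n) ≡ n
length-oneTo n = ≡.trans (length-map suc (upTo n)) (length-upTo n)

Perms-length : ∀ n → All (λ σ → length σ ≡ n) (Perms n)
Perms-length n = All.map (λ σ-len → ≡.trans σ-len (length-oneTo n)) (perms-length (oneTo n))

length-Perms : ∀ n → length (Perms n) ≡ n !
length-Perms n = ≡.trans (length-perms (oneTo n)) (cong _! (length-oneTo n))

module ResidueCount (n b : ℕ) .{{_ : NonZero n}} (a+b≤n : suc b + b ≤ n) where

  a : ℕ
  a = suc b

  residueCount : ℤ → ℕ
  residueCount s = length (filter (λ σ → + n ∣? D a b σ - s) (Perms n))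

  rotate-shifts-residue : ∀ s σ → length σ ≡ n →
    (+ n ∣ D a b (map (rotate n) σ) - (s ℤ.+ + 1)) ⇔ (+ n ∣ D a b σ - s)
  rotate-shifts-residue s σ σ-len =
    subst (λ z → (+ n ∣ z) ⇔ (+ n ∣ D a b σ - s)) (sym regroup)
          (∣-+-multiple (D-rotate-∣ n a b σ (subst (a + b ≤_) (sym σ-len) a+b≤n)))
    where
    Dρσ Dσ : ℤ
    Dρσ = D a b (map (rotate n) σ)
    Dσ  = D a b σ
    rearrange : ∀ (x y s β : ℤ) → x - (s ℤ.+ + 1) ≡ (y - s) ℤ.+ (x - (y ℤ.+ ((+ 1 ℤ.+ β) - β)))
    rearrange = solve-∀
    regroup : Dρσ - (s ℤ.+ + 1) ≡ (Dσ - s) ℤ.+ (Dρσ - (Dσ ℤ.+ (+ a - + b)))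
    regroup = ≡.trans (rearrange Dρσ Dσ s (+ b))
      (cong (λ α → (Dσ - s) ℤ.+ (Dρσ - (Dσ ℤ.+ (α - + b)))) (sym (ℤ.pos-+ 1 b)))

  residueCount-suc : ∀ s → residueCount (s ℤ.+ + 1) ≡ residueCount s
  residueCount-suc s = begin
    length (filter P?₊₁ (Perms n))                          ≡⟨ ↭-length (filter-↭ P?₊₁ (Perms-rotate n)) ⟩
    length (filter P?₊₁ (map (map (rotate n)) (Perms n)))   ≡⟨ length-filter-map P?₊₁ (map (rotate n)) (Perms n) ⟩
    length (filter (P?₊₁ ∘ map (rotate n)) (Perms n))
      ≡⟨ length-filter-cong _ _ (All.map (λ {σ} → rotate-shifts-residue s σ) (Perms-length n)) ⟩
    residueCount s                                          ∎
    where
    open ≡-Reasoning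
    P?₊₁ : Decidable (λ σ → + n ∣ D a b σ - (s ℤ.+ + 1))
    P?₊₁ = λ σ → + n ∣? D a b σ - (s ℤ.+ + 1)

  residueCount-+ : ∀ s k → residueCount (s ℤ.+ + k) ≡ residueCount s
  residueCount-+ s zero    = cong residueCount (ℤ.+-identityʳ s)
  residueCount-+ s (suc k) = begin
    residueCount (s ℤ.+ + suc k)            ≡⟨ cong residueCount (reassociate s (+ k)) ⟩
    residueCount ((s ℤ.+ + k) ℤ.+ + 1)      ≡⟨ residueCount-suc (s ℤ.+ + k) ⟩
    residueCount (s ℤ.+ + k)                ≡⟨ residueCount-+ s k ⟩
    residueCount s                          ∎
    where
    open ≡-Reasoning
    reassociate : ∀ s κ → s ℤ.+ (+ 1 ℤ.+ κ) ≡ (s ℤ.+ κ) ℤ.+ + 1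
    reassociate = solve-∀

  sum-residueCount : ∀ t → sumBelow n (λ k → residueCount (t ℤ.+ + k)) ≡ n !
  sum-residueCount t =
    ≡.trans (sumBelow-length-filter (λ k σ → + n ∣? D a b σ - (t ℤ.+ + k)) n
                                    (λ σ → exactly-one-residue n (D a b σ) t) (Perms n))
            (length-Perms n)

  n*residueCount : ∀ t → n * residueCount t ≡ n !
  n*residueCount t = begin
    n * residueCount t                            ≡⟨ sumBelow-const n (residueCount t) ⟨
    sumBelow n (λ _ → residueCount t)             ≡⟨ sumBelow-cong n (λ k _ → residueCount-+ t k) ⟨
    sumBelow n (λ k → residueCount (t ℤ.+ + k))   ≡⟨ sum-residueCount t ⟩
    n !                                           ∎
    where open ≡-Reasoning

lemma2 : (n a : ℕ) → 1 ≤ n → 2 ≤ a → 2 * a ∸ 1 < n → (t : ℤ) →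
    n * length (filter (λ σ → (+ n) ∣? (D a (a ∸ 1) σ - t)) (Perms n)) ≡ n !
lemma2 (suc m) (suc b) _ _ 2a∸1<n t = ResidueCount.n*residueCount (suc m) b a+b≤n t
  where
  2a∸1≡a+b : 2 * suc b ∸ 1 ≡ suc b + b
  2a∸1≡a+b = ≡.trans (cong (_+_ b) (+-identityʳ (suc b))) (+-suc b b)
  a+b≤n : suc b + b ≤ suc m
  a+b≤n = <⇒≤ (subst (_< suc m) 2a∸1≡a+b 2a∸1<n)
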